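{- Let $m\in\mathbb{Z}$ and let $p$ be a prime dividing $x^2-mx-1$ for some integer $x$, with $\gcd(p,m^2+4)=1$. Let $T_n(m)=\left(m^{i+j-n-1}\binom{i-1}{n-j}\right)_{1\le i,j\le n}$. Then $T_n(m)^{p-1}\equiv I_n\pmod p$ for every $n\ge1$, where $I_n$ is the $n\times n$ identity matrix.
   Context: Binomial coefficients $\binom{a}{b}$ are $0$ when $b<0$ or $b>a$; the entry $m^{i+j-n-1}\binom{i-1}{n-j}$ is $0$ when the binomial coefficient vanishes, so $T_n(m)$ is an integer matrix. Congruence of matrices modulo $p$ is entrywise. -}

module Defs where

open import Data.Nat as ℕ using (ℕ; _∸_; _<ᵇ_)
open import Data.Nat.Combinatorics using (_C_)
open import Data.Integer as ℤ using (ℤ; +_; _+_; _*_; _-_; _^_)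
open import Data.Integer.Divisibility using (_∣_)
open import Data.Fin using (Fin; toℕ; _≟_; zero; suc)
open import Data.Bool using (if_then_else_)
open import Relation.Nullary using (yes; no)

Mat : ℕ → Set
Mat n = Fin n → Fin n → ℤ

sumFin : ∀ {n} → (Fin n → ℤ) → ℤ
sumFin {ℕ.zero}  f = + 0
sumFin {ℕ.suc n} f = f zero + sumFin (λ k → f (suc k))

_⊗_ : ∀ {n} → Mat n → Mat n → Mat n
(A ⊗ B) i j = sumFin (λ k → A i k * B k j)

idMat : ∀ n → Mat n
idMat n i j with i ≟ j
... | yes _ = + 1
... | no  _ = + 0

matPow : ∀ {n} → Mat n → ℕ → Mat n
matPow {n} A ℕ.zero    = idMat n
matPow {n} A (ℕ.suc k) = matPow A k ⊗ A

-- T_n(m) with 1-based indices i = a+1, j = b+1 (a = toℕ i, b = toℕ j):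
-- entry m^(i+j-n-1) * binom(i-1, n-j) = m^(a+b+1-n) * binom(a, n-1-b),
-- which is 0 when a < n-1-b (binomial vanishes); otherwise the exponent is ≥ 0.
T : (n : ℕ) → ℤ → Mat n
T n m i j =
  let a = toℕ i ; b = toℕ j ; c = n ∸ 1 ∸ b in
  if a <ᵇ c then + 0 else (m ^ (a ℕ.+ b ℕ.+ 1 ∸ n)) * (+ (a C c))

_≡[mod_]_ : ∀ {n} → Mat n → ℤ → Mat n → Set
A ≡[mod p ] B = ∀ i j → p ∣ (A i j - B i j)

-- With A = [[0, 1], [1, m]], T_n(m) is the (n - 1)-th symmetric power of A: the substitution
-- f(X, Y) ↦ f(Y, X + m Y) on binary forms of degree n - 1. Hence T_n(m)ᵏ = Sym^(n-1)(Aᵏ), and it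
-- suffices that A^(p-1) ≡ I (mod p). The entries of Aᵏ are the numbers F_{k+2} = m F_{k+1} + F_k.
-- If α = x is a root of t² - m t - 1 modulo p, so is β = m - x, and since (α - β)² ≡ m² + 4 is a
-- unit, Binet's formula (α - β) F_k = αᵏ - βᵏ and Fermat's little theorem give F_p ≡ 1 and
-- F_{p+1} ≡ m. Running the recurrence backwards, F_{p-1} ≡ 0 and F_{p-2} ≡ 1, i.e. A^(p-1) ≡ I.

module Submission where

open import Defs
open import Data.Nat using (ℕ; suc; _≥_)
open import Data.Nat.Primality using (Prime)
open import Data.Nat.Coprimality using (Coprime)
open import Data.Integer using (ℤ; +_; _+_; _*_; _-_; ∣_∣)
open import Data.Integer.Divisibility using (_∣_)
open import Data.Product using (∃)
open import Data.Product using (_×_; _,_)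

open import Data.Nat using (zero; _≤_; _<_; z≤n; s≤s; _<ᵇ_; _∸_)
  renaming (_+_ to _+ℕ_; _*_ to _*ℕ_)
import Data.Nat.Properties as ℕP
open import Data.Nat.Combinatorics using (_C_; nCk+nC[k+1]≡[n+1]C[k+1]; k>n⇒nCk≡0; nC1≡n; nCn≡1)
import Data.Nat.Divisibility as ℕD
open import Data.Nat.Primality using (euclidsLemma; ¬prime[0]; ¬prime[1])
import Data.Nat.Tactic.RingSolver as ℕSolver
open import Data.Integer using (_^_; -_)
import Data.Integer.Divisibility.Signed as ℤSD
import Data.Integer.Properties as ℤP
import Data.Integer.DivMod as ℤDM
open import Data.Integer.Tactic.RingSolver using (solve-∀)
open import Data.Bool using (true; false; if_then_else_) renaming (T to IsTrue)
open import Data.Fin using (Fin; toℕ)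
open import Data.Unit using (tt)
open import Data.Empty using (⊥-elim)
open import Relation.Nullary using (yes; no; ¬_)
open import Data.Sum using (inj₁; inj₂)
open import Relation.Binary.PropositionalEquality
open import Function using (_∘_)
import Data.Fin.Properties as FinP
open import Relation.Binary.Bundles using (Setoid)
import Relation.Binary.Reasoning.Setoid

∑< : ℕ → (ℕ → ℤ) → ℤ
∑< zero    f = + 0
∑< (suc n) f = f 0 + ∑< n (λ k → f (suc k))

syntax ∑< n (λ k → e) = ∑[ k < n ] e

sumFin-cong : ∀ {n} {f g : Fin n → ℤ} → (∀ k → f k ≡ g k) → sumFin f ≡ sumFin g
sumFin-cong {zero}  e = refl
sumFin-cong {suc n} e = cong₂ _+_ (e Data.Fin.zero) (sumFin-cong (λ k → e (Data.Fin.suc k)))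

sumFin-toℕ : ∀ n (f : ℕ → ℤ) → sumFin {n} (λ k → f (toℕ k)) ≡ ∑< n f
sumFin-toℕ zero    f = refl
sumFin-toℕ (suc n) f = cong (_+_ (f 0)) (sumFin-toℕ n (λ k → f (suc k)))

∑<-cong : ∀ n {f g : ℕ → ℤ} → (∀ b → b < n → f b ≡ g b) → ∑< n f ≡ ∑< n g
∑<-cong zero    e = refl
∑<-cong (suc n) e = cong₂ _+_ (e 0 (s≤s z≤n)) (∑<-cong n (λ b b<n → e (suc b) (s≤s b<n)))

∑<-snoc : ∀ n (f : ℕ → ℤ) → ∑< (suc n) f ≡ ∑< n f + f n
∑<-snoc zero    f = ℤP.+-comm (f 0) (+ 0)
∑<-snoc (suc n) f = trans (cong (_+_ (f 0)) (∑<-snoc n (λ k → f (suc k))))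
                          (sym (ℤP.+-assoc (f 0) _ _))

∑<-+ : ∀ n (f g : ℕ → ℤ) → ∑[ b < n ] (f b + g b) ≡ ∑< n f + ∑< n g
∑<-+ zero    f g = refl
∑<-+ (suc n) f g = trans (cong (_+_ (f 0 + g 0)) (∑<-+ n _ _)) (interchange (f 0) (g 0) _ _)
  where
  interchange : ∀ (a b c d : ℤ) → a + b + (c + d) ≡ a + c + (b + d)
  interchange = solve-∀

∑<-*ˡ : ∀ n (u : ℤ) (f : ℕ → ℤ) → ∑[ b < n ] (u * f b) ≡ u * ∑< n f
∑<-*ˡ zero    u f = sym (ℤP.*-zeroʳ u)
∑<-*ˡ (suc n) u f = trans (cong (_+_ (u * f 0)) (∑<-*ˡ n u _)) (sym (ℤP.*-distribˡ-+ u (f 0) _))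

∑<-zero : ∀ n {f : ℕ → ℤ} → (∀ b → b < n → f b ≡ + 0) → ∑< n f ≡ + 0
∑<-zero zero    e = refl
∑<-zero (suc n) e = trans (cong₂ _+_ (e 0 (s≤s z≤n)) (∑<-zero n (λ b b<n → e (suc b) (s≤s b<n))))
                          (ℤP.+-identityˡ (+ 0))

if-<ᵇ-yes : ∀ {A : Set} {c n} {x y : A} → c < n → (if c <ᵇ n then x else y) ≡ x
if-<ᵇ-yes {c = c} {n} c<n with c <ᵇ n in eq
... | true  = refl
... | false = ⊥-elim (subst IsTrue eq (ℕP.<⇒<ᵇ c<n))

if-<ᵇ-no : ∀ {A : Set} {c n} {x y : A} → n ≤ c → (if c <ᵇ n then x else y) ≡ y
if-<ᵇ-no {c = c} {n} n≤c with c <ᵇ n in eq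
... | true  = ⊥-elim (ℕP.<⇒≱ (ℕP.<ᵇ⇒< c n (subst IsTrue (sym eq) tt)) n≤c)
... | false = refl

-- A sequence G : ℕ → ℤ stands for the polynomial ∑ G c tᶜ. Coefficients of degree ≥ n are
-- junk wherever a row of an n × n matrix is meant; truncate n discards them.
truncate : ℕ → (ℕ → ℤ) → ℕ → ℤ
truncate n G c = if c <ᵇ n then G c else + 0

shift : (ℕ → ℤ) → ℕ → ℤ
shift G zero    = + 0
shift G (suc c) = G c

truncate-< : ∀ n G {c} → c < n → truncate n G c ≡ G c
truncate-< n G c<n = if-<ᵇ-yes c<n

truncate-≥ : ∀ n G {c} → n ≤ c → truncate n G c ≡ + 0
truncate-≥ n G n≤c = if-<ᵇ-no n≤c

-- (u + v t) · G for G of degree < n.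
linMul : ℕ → ℤ → ℤ → (ℕ → ℤ) → ℕ → ℤ
linMul n u v G c = u * truncate n G c + v * shift G c

vecMul : ℕ → (ℕ → ℤ) → (ℕ → ℕ → ℤ) → ℕ → ℤ
vecMul n G F c = ∑[ b < n ] (G b * F b c)

truncate-vecMul : ∀ k n G F c → truncate k (vecMul n G F) c ≡ vecMul n G (λ b → truncate k (F b)) c
truncate-vecMul k n G F c with c ℕP.<? k
... | yes c<k = trans (truncate-< k (vecMul n G F) c<k)
                      (∑<-cong n (λ b _ → cong (G b *_) (sym (truncate-< k (F b) c<k))))
... | no  c≮k = trans (truncate-≥ k (vecMul n G F) (ℕP.≮⇒≥ c≮k)) (sym (∑<-zero n (λ b _ →
                  trans (cong (G b *_) (truncate-≥ k (F b) (ℕP.≮⇒≥ c≮k))) (ℤP.*-zeroʳ (G b)))))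

vecMul-truncate : ∀ n G F c → vecMul (suc n) (truncate n G) F c ≡ vecMul n G F c
vecMul-truncate n G F c = begin
  vecMul (suc n) (truncate n G) F c
    ≡⟨ ∑<-snoc n _ ⟩
  ∑[ b < n ] (truncate n G b * F b c) + truncate n G n * F n c
    ≡⟨ cong₂ _+_ (∑<-cong n (λ b b<n → cong (_* F b c) (truncate-< n G b<n)))
                 (cong (_* F n c) (truncate-≥ n G ℕP.≤-refl)) ⟩
  vecMul n G F c + + 0 * F n c
    ≡⟨ ℤP.+-identityʳ (vecMul n G F c) ⟩
  vecMul n G F c ∎
  where open ≡-Reasoning

vecMul-shift : ∀ n G F c → vecMul (suc n) (shift G) F c ≡ vecMul n G (λ b → F (suc b)) c
vecMul-shift n G F c = ℤP.+-identityˡ (vecMul n G (λ b → F (suc b)) c)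

vecMul-linCombˡ : ∀ n u v G H F c →
  vecMul n (λ b → u * G b + v * H b) F c ≡ u * vecMul n G F c + v * vecMul n H F c
vecMul-linCombˡ n u v G H F c = begin
  ∑[ b < n ] ((u * G b + v * H b) * F b c)
    ≡⟨ ∑<-cong n (λ b _ → distrib u (G b) v (H b) (F b c)) ⟩
  ∑[ b < n ] (u * (G b * F b c) + v * (H b * F b c))
    ≡⟨ ∑<-+ n _ _ ⟩
  ∑[ b < n ] (u * (G b * F b c)) + ∑[ b < n ] (v * (H b * F b c))
    ≡⟨ cong₂ _+_ (∑<-*ˡ n u _) (∑<-*ˡ n v _) ⟩
  u * vecMul n G F c + v * vecMul n H F c ∎
  where
  open ≡-Reasoning
  distrib : ∀ (u x v y z : ℤ) → (u * x + v * y) * z ≡ u * (x * z) + v * (y * z)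
  distrib = solve-∀

vecMul-linCombʳ : ∀ n G F F′ F″ u c c′ c″ → (∀ b → b < n → F b c ≡ F′ b c′ + u * F″ b c″) →
  vecMul n G F c ≡ vecMul n G F′ c′ + u * vecMul n G F″ c″
vecMul-linCombʳ n G F F′ F″ u c c′ c″ e = begin
  ∑[ b < n ] (G b * F b c)
    ≡⟨ ∑<-cong n (λ b b<n → trans (cong (G b *_) (e b b<n)) (distrib (G b) _ u _)) ⟩
  ∑[ b < n ] (G b * F′ b c′ + u * (G b * F″ b c″))
    ≡⟨ ∑<-+ n _ _ ⟩
  vecMul n G F′ c′ + ∑[ b < n ] (u * (G b * F″ b c″))
    ≡⟨ cong (_+_ (vecMul n G F′ c′)) (∑<-*ˡ n u _) ⟩
  vecMul n G F′ c′ + u * vecMul n G F″ c″ ∎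
  where
  open ≡-Reasoning
  distrib : ∀ (g x u y : ℤ) → g * (x + u * y) ≡ g * x + u * (g * y)
  distrib = solve-∀

powCoeff : ℤ → ℕ → ℕ → ℤ
powCoeff m a k = m ^ (a ∸ k) * + (a C k)

powCoeff-vanishes : ∀ m {a k} → a < k → powCoeff m a k ≡ + 0
powCoeff-vanishes m {a} {k} a<k rewrite k>n⇒nCk≡0 a<k = ℤP.*-zeroʳ (m ^ (a ∸ k))

powCoeff-suc : ∀ m a k → powCoeff m (suc a) (suc k) ≡ powCoeff m a k + m * powCoeff m a (suc k)
powCoeff-suc m a k with k ℕP.<? a
... | yes k<a = begin
  m ^ (a ∸ k) * + (suc a C suc k)
    ≡⟨ cong₂ (λ e c → m ^ e * c) a∸k≡1+a∸[1+k] (pascal a k) ⟩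
  m * m ^ (a ∸ suc k) * (+ (a C k) + + (a C suc k))
    ≡⟨ distrib m (m ^ (a ∸ suc k)) (+ (a C k)) (+ (a C suc k)) ⟩
  m * m ^ (a ∸ suc k) * + (a C k) + m * powCoeff m a (suc k)
    ≡⟨ cong (λ e → m ^ e * + (a C k) + m * powCoeff m a (suc k)) (sym a∸k≡1+a∸[1+k]) ⟩
  powCoeff m a k + m * powCoeff m a (suc k) ∎
  where
  open ≡-Reasoning
  a∸k≡1+a∸[1+k] : a ∸ k ≡ suc (a ∸ suc k)
  a∸k≡1+a∸[1+k] = ℕP.+-∸-assoc 1 k<a
  pascal : ∀ a k → + (suc a C suc k) ≡ + (a C k) + + (a C suc k)
  pascal a k = trans (cong +_ (sym (nCk+nC[k+1]≡[n+1]C[k+1] a k))) (ℤP.pos-+ (a C k) (a C suc k))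
  distrib : ∀ (m x y z : ℤ) → m * x * (y + z) ≡ m * x * y + m * (x * z)
  distrib = solve-∀
... | no  k≮a = begin
  powCoeff m (suc a) (suc k)
    ≡⟨ cong (λ c → m ^ (a ∸ k) * + c) (sym (nCk+nC[k+1]≡[n+1]C[k+1] a k)) ⟩
  m ^ (a ∸ k) * + ((a C k) +ℕ (a C suc k))
    ≡⟨ cong (λ c → m ^ (a ∸ k) * + ((a C k) +ℕ c)) (k>n⇒nCk≡0 (s≤s (ℕP.≮⇒≥ k≮a))) ⟩
  m ^ (a ∸ k) * + ((a C k) +ℕ 0)
    ≡⟨ cong (λ c → m ^ (a ∸ k) * + c) (ℕP.+-identityʳ (a C k)) ⟩
  powCoeff m a k
    ≡⟨ padZero (powCoeff m a k) m (m ^ (a ∸ suc k)) ⟩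
  powCoeff m a k + m * (m ^ (a ∸ suc k) * + 0)
    ≡⟨ cong (λ c → powCoeff m a k + m * (m ^ (a ∸ suc k) * + c))
            (sym (k>n⇒nCk≡0 (s≤s (ℕP.≮⇒≥ k≮a)))) ⟩
  powCoeff m a k + m * powCoeff m a (suc k) ∎
  where
  open ≡-Reasoning
  padZero : ∀ (x m y : ℤ) → x ≡ x + m * (y * + 0)
  padZero = solve-∀

tEntry : ℤ → ℕ → ℕ → ℕ → ℤ
tEntry m n a b = if a <ᵇ n ∸ 1 ∸ b then + 0 else m ^ (a +ℕ b +ℕ 1 ∸ n) * + (a C (n ∸ 1 ∸ b))

tEntry≡powCoeff : ∀ m {n} a {b} → b < n → tEntry m n a b ≡ powCoeff m a (n ∸ 1 ∸ b)
tEntry≡powCoeff m {suc n} a {b} (s≤s b≤n) with a ℕP.<? n ∸ b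
... | yes a<k = trans (if-<ᵇ-yes a<k) (sym (powCoeff-vanishes m a<k))
... | no  a≮k = trans (if-<ᵇ-no (ℕP.≮⇒≥ a≮k)) (cong (λ e → m ^ e * + (a C (n ∸ b))) exponent)
  where
  exponent : a +ℕ b +ℕ 1 ∸ suc n ≡ a ∸ (n ∸ b)
  exponent = begin
    a +ℕ b +ℕ 1 ∸ suc n          ≡⟨ cong (_∸ suc n) (ℕP.+-comm (a +ℕ b) 1) ⟩
    a +ℕ b ∸ n                    ≡⟨ cong₂ _∸_ (ℕP.+-comm a b) (sym (ℕP.m+[n∸m]≡n b≤n)) ⟩
    b +ℕ a ∸ (b +ℕ (n ∸ b))       ≡⟨ ℕP.[m+n]∸[m+o]≡n∸o b a (n ∸ b) ⟩
    a ∸ (n ∸ b)                   ∎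
    where open ≡-Reasoning

tEntry-firstColumn-vanishes : ∀ m {n b} → b < n → tEntry m (suc n) b 0 ≡ + 0
tEntry-firstColumn-vanishes m {n} {b} b<n =
  trans (tEntry≡powCoeff m b (s≤s z≤n)) (powCoeff-vanishes m b<n)

tEntry-dropColumn : ∀ m n b c → tEntry m (suc n) b (suc c) ≡ tEntry m n b c
tEntry-dropColumn m n b c = cong₂ (λ k e → if b <ᵇ k then + 0 else m ^ e * + (b C k))
  (sym (ℕP.∸-+-assoc n 1 c)) (cong (λ s → s +ℕ 1 ∸ suc n) (ℕP.+-suc b c))

tEntry-pascal : ∀ m n b {c} → c < n →
  tEntry m n (suc b) c ≡ truncate n (tEntry m n b) (suc c) + m * tEntry m n b c
tEntry-pascal m (suc n) b {c} c<n@(s≤s c≤n) with ℕP.m≤n⇒m<n∨m≡n c≤n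
... | inj₁ c<n′ = begin
  tEntry m (suc n) (suc b) c
    ≡⟨ tEntry≡powCoeff m (suc b) c<n ⟩
  powCoeff m (suc b) (n ∸ c)
    ≡⟨ cong (powCoeff m (suc b)) n∸c≡1+n∸[1+c] ⟩
  powCoeff m (suc b) (suc (n ∸ suc c))
    ≡⟨ powCoeff-suc m b (n ∸ suc c) ⟩
  powCoeff m b (n ∸ suc c) + m * powCoeff m b (suc (n ∸ suc c))
    ≡⟨ cong (λ k → powCoeff m b (n ∸ suc c) + m * powCoeff m b k) (sym n∸c≡1+n∸[1+c]) ⟩
  powCoeff m b (n ∸ suc c) + m * powCoeff m b (n ∸ c)
    ≡⟨ sym (cong₂ (λ x y → x + m * y)
              (trans (truncate-< (suc n) (tEntry m (suc n) b) (s≤s c<n′)) (tEntry≡powCoeff m b (s≤s c<n′)))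
              (tEntry≡powCoeff m b c<n)) ⟩
  truncate (suc n) (tEntry m (suc n) b) (suc c) + m * tEntry m (suc n) b c ∎
  where
  open ≡-Reasoning
  n∸c≡1+n∸[1+c] : n ∸ c ≡ suc (n ∸ suc c)
  n∸c≡1+n∸[1+c] = ℕP.+-∸-assoc 1 c<n′
... | inj₂ refl = begin
  tEntry m (suc c) (suc b) c
    ≡⟨ tEntry≡powCoeff m (suc b) c<n ⟩
  powCoeff m (suc b) (c ∸ c)
    ≡⟨ cong (powCoeff m (suc b)) (ℕP.n∸n≡0 c) ⟩
  m * m ^ b * + 1
    ≡⟨ lastColumn m (m ^ b) ⟩
  + 0 + m * (m ^ b * + 1)
    ≡⟨ cong₂ (λ x k → x + m * powCoeff m b k)
             (sym (truncate-≥ (suc c) (tEntry m (suc c) b) ℕP.≤-refl)) (sym (ℕP.n∸n≡0 c)) ⟩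
  truncate (suc c) (tEntry m (suc c) b) (suc c) + m * powCoeff m b (c ∸ c)
    ≡⟨ cong (λ x → truncate (suc c) (tEntry m (suc c) b) (suc c) + m * x)
             (sym (tEntry≡powCoeff m b c<n)) ⟩
  truncate (suc c) (tEntry m (suc c) b) (suc c) + m * tEntry m (suc c) b c ∎
  where
  open ≡-Reasoning
  lastColumn : ∀ (m x : ℤ) → m * x * + 1 ≡ + 0 + m * (x * + 1)
  lastColumn = solve-∀

-- Row vectors of length n times T n m: the substitution f(X, Y) ↦ f(Y, X + m Y) on binary
-- forms of degree n - 1, written in the dehomogenised variable t = Y / X.
module _ (m : ℤ) (G : ℕ → ℤ) where

  open ≡-Reasoning

  private
    R : ℕ → ℕ → ℤ
    R n = vecMul n G (tEntry m n)

  vecMul-tEntry-upperRows : ∀ n c → vecMul n G (tEntry m (suc n)) c ≡ shift (R n) c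
  vecMul-tEntry-upperRows n zero    = ∑<-zero n (λ b b<n →
    trans (cong (G b *_) (tEntry-firstColumn-vanishes m b<n)) (ℤP.*-zeroʳ (G b)))
  vecMul-tEntry-upperRows n (suc c) = ∑<-cong n (λ b _ → cong (G b *_) (tEntry-dropColumn m n b c))

  vecMul-tEntry-lowerRows : ∀ n c → c ≤ n →
    vecMul n G (λ b → tEntry m (suc n) (suc b)) c ≡ truncate n (R n) c + m * shift (R n) c
  vecMul-tEntry-lowerRows zero    zero    _         = sym (trans (ℤP.+-identityˡ (m * + 0)) (ℤP.*-zeroʳ m))
  vecMul-tEntry-lowerRows (suc n) zero    _         = begin
    vecMul (suc n) G (λ b → tEntry m (suc (suc n)) (suc b)) 0
      ≡⟨ vecMul-linCombʳ (suc n) G (λ b → tEntry m (suc (suc n)) (suc b)) (tEntry m (suc n))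
           (tEntry m (suc (suc n))) m 0 0 0 (λ b _ → pascal₀ b) ⟩
    R (suc n) 0 + m * vecMul (suc n) G (tEntry m (suc (suc n))) 0
      ≡⟨ cong₂ (λ x y → x + m * y) (sym (truncate-< (suc n) (R (suc n)) (s≤s z≤n)))
                                   (vecMul-tEntry-upperRows (suc n) 0) ⟩
    truncate (suc n) (R (suc n)) 0 + m * shift (R (suc n)) 0 ∎
    where
    pascal₀ : ∀ b → tEntry m (suc (suc n)) (suc b) 0 ≡ tEntry m (suc n) b 0 + m * tEntry m (suc (suc n)) b 0
    pascal₀ b = begin
      tEntry m (suc (suc n)) (suc b) 0
        ≡⟨ tEntry-pascal m (suc (suc n)) b (s≤s z≤n) ⟩
      truncate (suc (suc n)) (tEntry m (suc (suc n)) b) 1 + m * tEntry m (suc (suc n)) b 0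
        ≡⟨ cong (_+ m * tEntry m (suc (suc n)) b 0)
                (truncate-< (suc (suc n)) (tEntry m (suc (suc n)) b) (s≤s (s≤s z≤n))) ⟩
      tEntry m (suc (suc n)) b 1 + m * tEntry m (suc (suc n)) b 0
        ≡⟨ cong (_+ m * tEntry m (suc (suc n)) b 0) (tEntry-dropColumn m (suc n) b 0) ⟩
      tEntry m (suc n) b 0 + m * tEntry m (suc (suc n)) b 0 ∎
  vecMul-tEntry-lowerRows n       (suc c) c<n       = begin
    vecMul n G (λ b → tEntry m (suc n) (suc b)) (suc c)
      ≡⟨ vecMul-linCombʳ n G (λ b → tEntry m (suc n) (suc b)) (λ b → truncate n (tEntry m n b))
           (tEntry m n) m (suc c) (suc c) c (λ b _ →
           trans (tEntry-dropColumn m n (suc b) c) (tEntry-pascal m n b c<n)) ⟩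
    vecMul n G (λ b → truncate n (tEntry m n b)) (suc c) + m * R n c
      ≡⟨ cong (_+ m * R n c) (sym (truncate-vecMul n n G (tEntry m n) (suc c))) ⟩
    truncate n (R n) (suc c) + m * shift (R n) (suc c) ∎

  vecMul-linMul-tEntry : ∀ n u v c → c ≤ n →
    vecMul (suc n) (linMul n u v G) (tEntry m (suc n)) c ≡ linMul n v (u + v * m) (R n) c
  vecMul-linMul-tEntry n u v c c≤n = begin
    vecMul (suc n) (linMul n u v G) (tEntry m (suc n)) c
      ≡⟨ vecMul-linCombˡ (suc n) u v (truncate n G) (shift G) (tEntry m (suc n)) c ⟩
    u * vecMul (suc n) (truncate n G) (tEntry m (suc n)) c + v * vecMul (suc n) (shift G) (tEntry m (suc n)) c
      ≡⟨ cong₂ (λ x y → u * x + v * y) (vecMul-truncate n G (tEntry m (suc n)) c)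
                                       (vecMul-shift n G (tEntry m (suc n)) c) ⟩
    u * vecMul n G (tEntry m (suc n)) c + v * vecMul n G (λ b → tEntry m (suc n) (suc b)) c
      ≡⟨ cong₂ (λ x y → u * x + v * y) (vecMul-tEntry-upperRows n c) (vecMul-tEntry-lowerRows n c c≤n) ⟩
    u * shift (R n) c + v * (truncate n (R n) c + m * shift (R n) c)
      ≡⟨ regroup u (shift (R n) c) v (truncate n (R n) c) m ⟩
    linMul n v (u + v * m) (R n) c ∎
    where
    regroup : ∀ (u s v k m : ℤ) → u * s + v * (k + m * s) ≡ v * k + (u + v * m) * s
    regroup = solve-∀

-- Symmetric powers of 2 × 2 matrices

δ : ℕ → ℕ → ℤ
δ zero    zero    = + 1
δ zero    (suc _) = + 0
δ (suc _) zero    = + 0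
δ (suc a) (suc c) = δ a c

δ-refl : ∀ a → δ a a ≡ + 1
δ-refl zero    = refl
δ-refl (suc a) = δ-refl a

δ-≢ : ∀ a c → a ≢ c → δ a c ≡ + 0
δ-≢ zero    zero    a≢c = ⊥-elim (a≢c refl)
δ-≢ zero    (suc c) _   = refl
δ-≢ (suc a) zero    _   = refl
δ-≢ (suc a) (suc c) a≢c = δ-≢ a c (a≢c ∘ cong suc)

idMat≡δ : ∀ n (i j : Fin n) → idMat n i j ≡ δ (toℕ i) (toℕ j)
idMat≡δ n i j with i Data.Fin.≟ j
... | yes refl = sym (δ-refl (toℕ i))
... | no  i≢j  = sym (δ-≢ (toℕ i) (toℕ j) (i≢j ∘ FinP.toℕ-injective))

data Mat₂ : Set where
  mat₂ : (x y z w : ℤ) → Mat₂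

I₂ : Mat₂
I₂ = mat₂ (+ 1) (+ 0) (+ 0) (+ 1)

-- M · [[0, 1], [1, m]], for M = mat₂ x y z w = [[x, y], [z, w]].
mulCompanion : ℤ → Mat₂ → Mat₂
mulCompanion m (mat₂ x y z w) = mat₂ y (x + y * m) w (z + w * m)

companionPow : ℤ → ℕ → Mat₂
companionPow m zero    = I₂
companionPow m (suc k) = mulCompanion m (companionPow m k)

-- Row a of the N-th symmetric power of [[x, y], [z, w]]: (x + y t)^(N - a) (z + w t)^a.
symPowRow : ℕ → Mat₂ → ℕ → ℕ → ℤ
symPowRow zero    M                a       = δ 0
symPowRow (suc N) M@(mat₂ x y z w) zero    = linMul (suc N) x y (symPowRow N M zero)
symPowRow (suc N) M@(mat₂ x y z w) (suc a) = linMul (suc N) z w (symPowRow N M a)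

linMul-cong : ∀ n u v {F F′ : ℕ → ℤ} → (∀ c → c < n → F c ≡ F′ c) →
  ∀ c → c ≤ n → linMul n u v F c ≡ linMul n u v F′ c
linMul-cong n u v {F} {F′} F≡F′ c c≤n = cong₂ (λ x y → u * x + v * y) truncated (shifted c c≤n)
  where
  truncated : truncate n F c ≡ truncate n F′ c
  truncated with c ℕP.<? n
  ... | yes c<n = trans (truncate-< n F c<n) (trans (F≡F′ c c<n) (sym (truncate-< n F′ c<n)))
  ... | no  c≮n = trans (truncate-≥ n F (ℕP.≮⇒≥ c≮n)) (sym (truncate-≥ n F′ (ℕP.≮⇒≥ c≮n)))
  shifted : ∀ c → c ≤ n → shift F c ≡ shift F′ c
  shifted zero    _   = refl
  shifted (suc c) c<n = F≡F′ c c<n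

linMul-1-0 : ∀ n F c → linMul n (+ 1) (+ 0) F c ≡ truncate n F c
linMul-1-0 n F c = solve (truncate n F c) (shift F c)
  where
  solve : ∀ (x y : ℤ) → + 1 * x + + 0 * y ≡ x
  solve = solve-∀

linMul-0-1 : ∀ n F c → linMul n (+ 0) (+ 1) F c ≡ shift F c
linMul-0-1 n F c = solve (truncate n F c) (shift F c)
  where
  solve : ∀ (x y : ℤ) → + 0 * x + + 1 * y ≡ y
  solve = solve-∀

symPowRow-I₂ : ∀ N a c → a ≤ N → c ≤ N → symPowRow N I₂ a c ≡ δ a c
symPowRow-I₂ zero    zero    c       _         _   = refl
symPowRow-I₂ (suc N) zero    c       _         c≤N with ℕP.m≤n⇒m<n∨m≡n c≤N
... | inj₁ c<N = trans (linMul-1-0 (suc N) (symPowRow N I₂ 0) c)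
                       (trans (truncate-< (suc N) (symPowRow N I₂ 0) c<N)
                              (symPowRow-I₂ N 0 c z≤n (ℕP.≤-pred c<N)))
... | inj₂ refl = trans (linMul-1-0 (suc N) (symPowRow N I₂ 0) (suc N))
                        (truncate-≥ (suc N) (symPowRow N I₂ 0) ℕP.≤-refl)
symPowRow-I₂ (suc N) (suc a) zero    _         _   = linMul-0-1 (suc N) (symPowRow N I₂ a) 0
symPowRow-I₂ (suc N) (suc a) (suc c) (s≤s a≤N) (s≤s c≤N) =
  trans (linMul-0-1 (suc N) (symPowRow N I₂ a) (suc c)) (symPowRow-I₂ N a c a≤N c≤N)

symPowRow-mulCompanion : ∀ m N M a c → c ≤ N →
  vecMul (suc N) (symPowRow N M a) (tEntry m (suc N)) c ≡ symPowRow N (mulCompanion m M) a c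
symPowRow-mulCompanion m zero    (mat₂ x y z w) a       zero    _   = refl
symPowRow-mulCompanion m (suc N) M@(mat₂ x y z w) zero    c       c≤N =
  trans (vecMul-linMul-tEntry m (symPowRow N M 0) (suc N) x y c c≤N)
        (linMul-cong (suc N) y (x + y * m)
           (λ c′ c′<N → symPowRow-mulCompanion m N M 0 c′ (ℕP.≤-pred c′<N)) c c≤N)
symPowRow-mulCompanion m (suc N) M@(mat₂ x y z w) (suc a) c       c≤N =
  trans (vecMul-linMul-tEntry m (symPowRow N M a) (suc N) z w c c≤N)
        (linMul-cong (suc N) w (z + w * m)
           (λ c′ c′<N → symPowRow-mulCompanion m N M a c′ (ℕP.≤-pred c′<N)) c c≤N)

matPow-T≡symPowRow : ∀ m N k (i j : Fin (suc N)) →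
  matPow (T (suc N) m) k i j ≡ symPowRow N (companionPow m k) (toℕ i) (toℕ j)
matPow-T≡symPowRow m N zero    i j = trans (idMat≡δ (suc N) i j)
  (sym (symPowRow-I₂ N (toℕ i) (toℕ j) (ℕP.≤-pred (FinP.toℕ<n i)) (ℕP.≤-pred (FinP.toℕ<n j))))
matPow-T≡symPowRow m N (suc k) i j = begin
  sumFin {suc N} (λ l → matPow (T (suc N) m) k i l * T (suc N) m l j)
    ≡⟨ sumFin-cong {suc N} (λ l → cong (_* T (suc N) m l j) (matPow-T≡symPowRow m N k i l)) ⟩
  sumFin {suc N} (λ l → symPowRow N (companionPow m k) (toℕ i) (toℕ l) * tEntry m (suc N) (toℕ l) (toℕ j))
    ≡⟨ sumFin-toℕ (suc N) (λ b → symPowRow N (companionPow m k) (toℕ i) b * tEntry m (suc N) b (toℕ j)) ⟩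
  vecMul (suc N) (symPowRow N (companionPow m k) (toℕ i)) (tEntry m (suc N)) (toℕ j)
    ≡⟨ symPowRow-mulCompanion m N (companionPow m k) (toℕ i) (toℕ j) (ℕP.≤-pred (FinP.toℕ<n j)) ⟩
  symPowRow N (companionPow m (suc k)) (toℕ i) (toℕ j) ∎
  where open ≡-Reasoning

infix 4 _≡_[mod_]
record _≡_[mod_] (a b : ℤ) (p : ℕ) : Set where
  constructor congruent
  field
    quotient    : ℤ
    quotient-eq : a ≡ b + quotient * + p

module _ {p : ℕ} where

  mod-reflexive : ∀ {a b} → a ≡ b → a ≡ b [mod p ]
  mod-reflexive {a} refl = congruent (+ 0) (solve a (+ p))
    where
    solve : ∀ (a p : ℤ) → a ≡ a + + 0 * p
    solve = solve-∀

  mod-refl : ∀ {a} → a ≡ a [mod p ]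
  mod-refl = mod-reflexive refl

  mod-sym : ∀ {a b} → a ≡ b [mod p ] → b ≡ a [mod p ]
  mod-sym {b = b} (congruent q refl) = congruent (- q) (solve b q (+ p))
    where
    solve : ∀ (b q p : ℤ) → b ≡ b + q * p + - q * p
    solve = solve-∀

  mod-trans : ∀ {a b c} → a ≡ b [mod p ] → b ≡ c [mod p ] → a ≡ c [mod p ]
  mod-trans {c = c} (congruent q refl) (congruent q′ refl) = congruent (q′ + q) (solve c q q′ (+ p))
    where
    solve : ∀ (c q q′ p : ℤ) → c + q′ * p + q * p ≡ c + (q′ + q) * p
    solve = solve-∀

  +-cong-mod : ∀ {a a′ b b′} → a ≡ a′ [mod p ] → b ≡ b′ [mod p ] → a + b ≡ a′ + b′ [mod p ]
  +-cong-mod {a′ = a′} {b′ = b′} (congruent q refl) (congruent q′ refl) =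
    congruent (q + q′) (solve a′ b′ q q′ (+ p))
    where
    solve : ∀ (a b q q′ p : ℤ) → a + q * p + (b + q′ * p) ≡ a + b + (q + q′) * p
    solve = solve-∀

  *-cong-mod : ∀ {a a′ b b′} → a ≡ a′ [mod p ] → b ≡ b′ [mod p ] → a * b ≡ a′ * b′ [mod p ]
  *-cong-mod {a′ = a′} {b′ = b′} (congruent q refl) (congruent q′ refl) =
    congruent (q * b′ + a′ * q′ + q * q′ * + p) (solve a′ b′ q q′ (+ p))
    where
    solve : ∀ (a b q q′ p : ℤ) → (a + q * p) * (b + q′ * p) ≡ a * b + (q * b + a * q′ + q * q′ * p) * p
    solve = solve-∀

  neg-cong-mod : ∀ {a a′} → a ≡ a′ [mod p ] → - a ≡ - a′ [mod p ]
  neg-cong-mod {a′ = a′} (congruent q refl) = congruent (- q) (solve a′ q (+ p))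
    where
    solve : ∀ (a q p : ℤ) → - (a + q * p) ≡ - a + - q * p
    solve = solve-∀

  sub-cong-mod : ∀ {a a′ b b′} → a ≡ a′ [mod p ] → b ≡ b′ [mod p ] → a - b ≡ a′ - b′ [mod p ]
  sub-cong-mod a≡a′ b≡b′ = +-cong-mod a≡a′ (neg-cong-mod b≡b′)

  ^-cong-mod : ∀ {a b} → a ≡ b [mod p ] → ∀ k → a ^ k ≡ b ^ k [mod p ]
  ^-cong-mod a≡b zero    = mod-refl
  ^-cong-mod a≡b (suc k) = *-cong-mod a≡b (^-cong-mod a≡b k)

  mod⇒∣ : ∀ {a b} → a ≡ b [mod p ] → + p ∣ a - b
  mod⇒∣ {a} {b} (congruent q refl) = ℤSD.∣⇒∣ᵤ (ℤSD.divides q (solve b q (+ p)))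
    where
    solve : ∀ (b q p : ℤ) → b + q * p - b ≡ q * p
    solve = solve-∀

  ∣⇒mod : ∀ {a b} → + p ∣ a - b → a ≡ b [mod p ]
  ∣⇒mod {a} {b} p∣a-b with ℤSD.∣ᵤ⇒∣ p∣a-b
  ... | ℤSD.divides q a-b≡qp = congruent q (trans (solve a b) (cong (_+_ b) a-b≡qp))
    where
    solve : ∀ (a b : ℤ) → a ≡ b + (a - b)
    solve = solve-∀

mod-setoid : ℕ → Setoid _ _
mod-setoid p = record
  { Carrier       = ℤ
  ; _≈_           = _≡_[mod p ]
  ; isEquivalence = record { refl = mod-refl ; sym = mod-sym ; trans = mod-trans }
  }

module ModReasoning (p : ℕ) = Relation.Binary.Reasoning.Setoid (mod-setoid p)

infix 4 _≡₂_[mod_]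
_≡₂_[mod_] : Mat₂ → Mat₂ → ℕ → Set
mat₂ x y z w ≡₂ mat₂ x′ y′ z′ w′ [mod p ] =
  x ≡ x′ [mod p ] × y ≡ y′ [mod p ] × z ≡ z′ [mod p ] × w ≡ w′ [mod p ]

module _ {p : ℕ} where

  linMul-cong-mod : ∀ n {u u′ v v′} {F F′ : ℕ → ℤ} → u ≡ u′ [mod p ] → v ≡ v′ [mod p ] →
    (∀ c → F c ≡ F′ c [mod p ]) → ∀ c → linMul n u v F c ≡ linMul n u′ v′ F′ c [mod p ]
  linMul-cong-mod n {F = F} {F′} u≡u′ v≡v′ F≡F′ c =
    +-cong-mod (*-cong-mod u≡u′ truncated) (*-cong-mod v≡v′ (shifted c))
    where
    truncated : truncate n F c ≡ truncate n F′ c [mod p ]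
    truncated with c <ᵇ n
    ... | true  = F≡F′ c
    ... | false = mod-refl
    shifted : ∀ c → shift F c ≡ shift F′ c [mod p ]
    shifted zero    = mod-refl
    shifted (suc c) = F≡F′ c

  symPowRow-cong-mod : ∀ {M M′} → M ≡₂ M′ [mod p ] →
    ∀ N a c → symPowRow N M a c ≡ symPowRow N M′ a c [mod p ]
  symPowRow-cong-mod                  M≡M′                       zero    a       c = mod-refl
  symPowRow-cong-mod {mat₂ _ _ _ _} {mat₂ _ _ _ _} M≡M′@(x≡ , y≡ , _ , _) (suc N) zero    c =
    linMul-cong-mod (suc N) x≡ y≡ (symPowRow-cong-mod M≡M′ N 0) c
  symPowRow-cong-mod {mat₂ _ _ _ _} {mat₂ _ _ _ _} M≡M′@(_ , _ , z≡ , w≡) (suc N) (suc a) c =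
    linMul-cong-mod (suc N) z≡ w≡ (symPowRow-cong-mod M≡M′ N a) c

-- Fermat's little theorem

∑-pascal : ∀ (a : ℤ) n →
  ∑[ k < suc n ] (+ (suc n C suc k) * a ^ suc k) ≡
  a * ∑[ k < suc n ] (+ (n C k) * a ^ k) + ∑[ k < suc n ] (+ (n C suc k) * a ^ suc k)
∑-pascal a n = begin
  ∑[ k < suc n ] (+ (suc n C suc k) * a ^ suc k)
    ≡⟨ ∑<-cong (suc n) (λ k _ → trans
         (cong (λ c → + c * a ^ suc k) (sym (nCk+nC[k+1]≡[n+1]C[k+1] n k)))
         (distrib (n C k) (n C suc k) a (a ^ k))) ⟩
  ∑[ k < suc n ] (a * (+ (n C k) * a ^ k) + + (n C suc k) * a ^ suc k)
    ≡⟨ ∑<-+ (suc n) (λ k → a * (+ (n C k) * a ^ k)) (λ k → + (n C suc k) * a ^ suc k) ⟩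
  ∑[ k < suc n ] (a * (+ (n C k) * a ^ k)) + ∑[ k < suc n ] (+ (n C suc k) * a ^ suc k)
    ≡⟨ cong (_+ ∑[ k < suc n ] (+ (n C suc k) * a ^ suc k)) (∑<-*ˡ (suc n) a (λ k → + (n C k) * a ^ k)) ⟩
  a * ∑[ k < suc n ] (+ (n C k) * a ^ k) + ∑[ k < suc n ] (+ (n C suc k) * a ^ suc k) ∎
  where
  open ≡-Reasoning
  distrib : ∀ x y (a b : ℤ) → + (x +ℕ y) * (a * b) ≡ a * (+ x * b) + + y * (a * b)
  distrib x y a b rewrite ℤP.pos-+ x y = solve a b (+ x) (+ y)
    where
    solve : ∀ (a b x y : ℤ) → (x + y) * (a * b) ≡ a * (x * b) + y * (a * b)
    solve = solve-∀

binomial-theorem : ∀ (a : ℤ) n → (a + + 1) ^ n ≡ + 1 + ∑[ k < n ] (+ (n C suc k) * a ^ suc k)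
binomial-theorem a zero    = refl
binomial-theorem a (suc n) = begin
  (a + + 1) * (a + + 1) ^ n
    ≡⟨ cong ((a + + 1) *_) (binomial-theorem a n) ⟩
  (a + + 1) * (+ 1 + Q n)
    ≡⟨ expand a (Q n) ⟩
  -- + 1 + Q n computes to ∑[ k < suc n ] (+ (n C k) * a ^ k).
  + 1 + (a * (+ 1 + Q n) + Q n)
    ≡⟨ cong (λ s → + 1 + (a * (+ 1 + Q n) + s)) (sym lastTermVanishes) ⟩
  + 1 + (a * ∑[ k < suc n ] (+ (n C k) * a ^ k) + ∑[ k < suc n ] (+ (n C suc k) * a ^ suc k))
    ≡⟨ cong (_+_ (+ 1)) (sym (∑-pascal a n)) ⟩
  + 1 + Q (suc n) ∎
  where
  open ≡-Reasoning
  Q : ℕ → ℤ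
  Q n = ∑[ k < n ] (+ (n C suc k) * a ^ suc k)
  expand : ∀ (a q : ℤ) → (a + + 1) * (+ 1 + q) ≡ + 1 + (a * (+ 1 + q) + q)
  expand = solve-∀
  lastTermVanishes : ∑[ k < suc n ] (+ (n C suc k) * a ^ suc k) ≡ Q n
  lastTermVanishes = begin
    ∑[ k < suc n ] (+ (n C suc k) * a ^ suc k)
      ≡⟨ ∑<-snoc n _ ⟩
    Q n + + (n C suc n) * a ^ suc n
      ≡⟨ cong (λ c → Q n + + c * a ^ suc n) (k>n⇒nCk≡0 {n} {suc n} ℕP.≤-refl) ⟩
    Q n + + 0 * a ^ suc n
      ≡⟨ cong (_+_ (Q n)) (ℤP.*-zeroˡ (a ^ suc n)) ⟩
    Q n + + 0
      ≡⟨ ℤP.+-identityʳ (Q n) ⟩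
    Q n ∎

suc-*-C : ∀ n k → suc k *ℕ (suc n C suc k) ≡ suc n *ℕ (n C k)
suc-*-C zero    zero    = refl
suc-*-C zero    (suc k)
  rewrite k>n⇒nCk≡0 {1} {suc (suc k)} (s≤s (s≤s z≤n)) | k>n⇒nCk≡0 {0} {suc k} (s≤s z≤n) =
  ℕP.*-zeroʳ (suc (suc k))
suc-*-C (suc n) zero    =
  trans (ℕP.*-identityˡ _) (trans (nC1≡n (suc (suc n))) (sym (ℕP.*-identityʳ (suc (suc n)))))
suc-*-C (suc n) (suc k) = begin
  suc (suc k) *ℕ (suc (suc n) C suc (suc k))
    ≡⟨ cong (suc (suc k) *ℕ_) (sym (nCk+nC[k+1]≡[n+1]C[k+1] (suc n) (suc k))) ⟩
  suc (suc k) *ℕ ((suc n C suc k) +ℕ (suc n C suc (suc k)))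
    ≡⟨ split k (suc n C suc k) (suc n C suc (suc k)) ⟩
  suc k *ℕ (suc n C suc k) +ℕ (suc n C suc k) +ℕ suc (suc k) *ℕ (suc n C suc (suc k))
    ≡⟨ cong₂ (λ x y → x +ℕ (suc n C suc k) +ℕ y) (suc-*-C n k) (suc-*-C n (suc k)) ⟩
  suc n *ℕ (n C k) +ℕ (suc n C suc k) +ℕ suc n *ℕ (n C suc k)
    ≡⟨ merge n (n C k) (suc n C suc k) (n C suc k) ⟩
  suc n *ℕ ((n C k) +ℕ (n C suc k)) +ℕ (suc n C suc k)
    ≡⟨ cong (λ c → suc n *ℕ c +ℕ (suc n C suc k)) (nCk+nC[k+1]≡[n+1]C[k+1] n k) ⟩
  suc n *ℕ (suc n C suc k) +ℕ (suc n C suc k)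
    ≡⟨ ℕP.+-comm (suc n *ℕ (suc n C suc k)) _ ⟩
  suc (suc n) *ℕ (suc n C suc k) ∎
  where
  open ≡-Reasoning
  split : ∀ k x y → suc (suc k) *ℕ (x +ℕ y) ≡ suc k *ℕ x +ℕ x +ℕ suc (suc k) *ℕ y
  split = ℕSolver.solve-∀
  merge : ∀ n a b c → suc n *ℕ a +ℕ b +ℕ suc n *ℕ c ≡ suc n *ℕ (a +ℕ c) +ℕ b
  merge = ℕSolver.solve-∀

prime∣C : ∀ {n} k → Prime (suc n) → suc k < suc n → suc n ℕD.∣ (suc n C suc k)
prime∣C {n} k p-prime k<p with euclidsLemma (suc k) (suc n C suc k) p-prime
                                  (ℕD.divides (n C k) (trans (suc-*-C n k) (ℕP.*-comm (suc n) (n C k))))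
... | inj₁ p∣k = ⊥-elim (ℕP.<⇒≱ k<p (ℕD.∣⇒≤ p∣k))
... | inj₂ p∣C = p∣C

∣⇒≡0-mod : ∀ {p c} → p ℕD.∣ c → + c ≡ + 0 [mod p ]
∣⇒≡0-mod {p} (ℕD.divides q refl) = congruent (+ q) (trans (ℤP.pos-* q p) (sym (ℤP.+-identityˡ _)))

∑<-cong-mod : ∀ {p} n {f g : ℕ → ℤ} → (∀ b → b < n → f b ≡ g b [mod p ]) →
  ∑< n f ≡ ∑< n g [mod p ]
∑<-cong-mod zero    f≡g = mod-refl
∑<-cong-mod (suc n) f≡g = +-cong-mod (f≡g 0 (s≤s z≤n)) (∑<-cong-mod n (λ b b<n → f≡g (suc b) (s≤s b<n)))

freshman's-dream : ∀ {n} → Prime (suc n) → ∀ a → (a + + 1) ^ suc n ≡ a ^ suc n + + 1 [mod suc n ]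
freshman's-dream {n} p-prime a = begin
  (a + + 1) ^ suc n
    ≡⟨ binomial-theorem a (suc n) ⟩
  + 1 + ∑[ k < suc n ] (+ (suc n C suc k) * a ^ suc k)
    ≡⟨ cong (_+_ (+ 1)) (∑<-snoc n _) ⟩
  + 1 + (∑[ k < n ] (+ (suc n C suc k) * a ^ suc k) + + (suc n C suc n) * a ^ suc n)
    ≈⟨ +-cong-mod (mod-refl {a = + 1}) (+-cong-mod innerTermsVanish (mod-refl {a = + (suc n C suc n) * a ^ suc n})) ⟩
  + 1 + (∑[ k < n ] (+ 0) + + (suc n C suc n) * a ^ suc n)
    ≡⟨ cong (λ s → + 1 + (s + + (suc n C suc n) * a ^ suc n)) (∑<-zero n (λ _ _ → refl)) ⟩
  + 1 + (+ 0 + + (suc n C suc n) * a ^ suc n)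
    ≡⟨ cong (λ c → + 1 + (+ 0 + + c * a ^ suc n)) (nCn≡1 (suc n)) ⟩
  + 1 + (+ 0 + + 1 * a ^ suc n)
    ≡⟨ solve (a ^ suc n) ⟩
  a ^ suc n + + 1 ∎
  where
  open ModReasoning (suc n)
  innerTermsVanish : ∑[ k < n ] (+ (suc n C suc k) * a ^ suc k) ≡ ∑[ k < n ] (+ 0) [mod suc n ]
  innerTermsVanish = ∑<-cong-mod n (λ k k<n →
    mod-trans (*-cong-mod (∣⇒≡0-mod (prime∣C k p-prime (s≤s k<n))) mod-refl)
              (mod-reflexive (ℤP.*-zeroˡ (a ^ suc k))))
  solve : ∀ (x : ℤ) → + 1 + (+ 0 + + 1 * x) ≡ x + + 1
  solve = solve-∀

fermat-ℕ : ∀ {n} → Prime (suc n) → ∀ k → (+ k) ^ suc n ≡ + k [mod suc n ]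
fermat-ℕ p-prime zero    = mod-refl
fermat-ℕ {n} p-prime (suc k) = begin
  (+ suc k) ^ suc n         ≡⟨ cong (_^ suc n) +suc≡+1 ⟩
  (+ k + + 1) ^ suc n       ≈⟨ freshman's-dream p-prime (+ k) ⟩
  (+ k) ^ suc n + + 1       ≈⟨ +-cong-mod (fermat-ℕ p-prime k) (mod-refl {a = + 1}) ⟩
  + k + + 1                 ≡⟨ sym +suc≡+1 ⟩
  + suc k                   ∎
  where
  open ModReasoning (suc n)
  +suc≡+1 : + suc k ≡ + k + + 1
  +suc≡+1 = trans (cong +_ (ℕP.+-comm 1 k)) (ℤP.pos-+ k 1)

-- Prime 0 and Prime 1 are empty, so one clause covers all primes.
fermat : ∀ {p} → Prime p → ∀ a → a ^ p ≡ a [mod p ]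
fermat {suc (suc n)} p-prime a =
  mod-trans (^-cong-mod a≡a%p (suc (suc n))) (mod-trans (fermat-ℕ p-prime _) (mod-sym a≡a%p))
  where
  a≡a%p : a ≡ + (a ℤDM.%ℕ suc (suc n)) [mod suc (suc n) ]
  a≡a%p = congruent (a ℤDM./ℕ suc (suc n)) (ℤDM.a≡a%ℕn+[a/ℕn]*n a (suc (suc n)))

*-cancelˡ-mod : ∀ {p} → Prime p → ∀ {d a b} → ¬ (d ≡ + 0 [mod p ]) →
  d * a ≡ d * b [mod p ] → a ≡ b [mod p ]
*-cancelˡ-mod {p} p-prime {d} {a} {b} d≢0 da≡db
  with euclidsLemma ∣ d ∣ ∣ a - b ∣ p-prime p∣∣d∣*∣a-b∣
  where
  p∣∣d∣*∣a-b∣ : p ℕD.∣ ∣ d ∣ *ℕ ∣ a - b ∣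
  p∣∣d∣*∣a-b∣ = subst (p ℕD.∣_) (ℤP.abs-* d (a - b))
                  (subst (λ z → + p ∣ z) (solve d a b) (mod⇒∣ da≡db))
    where
    solve : ∀ (d a b : ℤ) → d * a - d * b ≡ d * (a - b)
    solve = solve-∀
... | inj₁ p∣d   = ⊥-elim (d≢0 (∣⇒mod (subst (λ z → + p ∣ z) (sym (ℤP.+-identityʳ d)) p∣d)))
... | inj₂ p∣a-b = ∣⇒mod p∣a-b

-- Generalised Fibonacci numbers

fib : ℤ → ℕ → ℤ
fib m zero          = + 0
fib m (suc zero)    = + 1
fib m (suc (suc k)) = m * fib m (suc k) + fib m k

companionPow-fib : ∀ m k →
  companionPow m (suc k) ≡ mat₂ (fib m k) (fib m (suc k)) (fib m (suc k)) (fib m (suc (suc k)))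
companionPow-fib m zero    = cong₂ (λ y w → mat₂ (+ 0) y (+ 1) w) (solve₁ m) (solve₂ m)
  where
  solve₁ : ∀ (m : ℤ) → + 1 + + 0 * m ≡ + 1
  solve₁ = solve-∀
  solve₂ : ∀ (m : ℤ) → + 0 + + 1 * m ≡ m * + 1 + + 0
  solve₂ = solve-∀
companionPow-fib m (suc k) rewrite companionPow-fib m k =
  cong₂ (λ y w → mat₂ (fib m (suc k)) y (fib m (suc (suc k))) w)
        (solve (fib m k) (fib m (suc k)) m) (solve (fib m (suc k)) (fib m (suc (suc k))) m)
  where
  solve : ∀ (a b m : ℤ) → a + b * m ≡ m * b + a
  solve = solve-∀

module _ {p : ℕ} (m α β : ℤ)
         (α-root : α * α ≡ m * α + + 1 [mod p ]) (β-root : β * β ≡ m * β + + 1 [mod p ]) where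

  binet : ∀ k → (α - β) * fib m k ≡ α ^ k - β ^ k [mod p ]
  binet zero          = mod-reflexive (solve (α - β))
    where
    solve : ∀ (d : ℤ) → d * + 0 ≡ + 1 - + 1
    solve = solve-∀
  binet (suc zero)    = mod-reflexive (solve α β)
    where
    solve : ∀ (a b : ℤ) → (a - b) * + 1 ≡ a * + 1 - b * + 1
    solve = solve-∀
  binet (suc (suc k)) = begin
    (α - β) * (m * fib m (suc k) + fib m k)
      ≡⟨ solve₁ (α - β) m (fib m (suc k)) (fib m k) ⟩
    m * ((α - β) * fib m (suc k)) + (α - β) * fib m k
      ≈⟨ +-cong-mod (*-cong-mod (mod-refl {a = m}) (binet (suc k))) (binet k) ⟩
    m * (α * α ^ k - β * β ^ k) + (α ^ k - β ^ k)
      ≡⟨ solve₂ m α β (α ^ k) (β ^ k) ⟩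
    (m * α + + 1) * α ^ k - (m * β + + 1) * β ^ k
      ≈⟨ sub-cong-mod (*-cong-mod (mod-sym α-root) (mod-refl {a = α ^ k}))
                      (*-cong-mod (mod-sym β-root) (mod-refl {a = β ^ k})) ⟩
    α * α * α ^ k - β * β * β ^ k
      ≡⟨ solve₃ α β (α ^ k) (β ^ k) ⟩
    α * (α * α ^ k) - β * (β * β ^ k) ∎
    where
    open ModReasoning p
    solve₁ : ∀ (d m a b : ℤ) → d * (m * a + b) ≡ m * (d * a) + d * b
    solve₁ = solve-∀
    solve₂ : ∀ (m a b A B : ℤ) → m * (a * A - b * B) + (A - B) ≡ (m * a + + 1) * A - (m * b + + 1) * B
    solve₂ = solve-∀
    solve₃ : ∀ (a b A B : ℤ) → a * a * A - b * b * B ≡ a * (a * A) - b * (b * B)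
    solve₃ = solve-∀

  module _ (p-prime : Prime p) (distinct : ¬ (α - β ≡ + 0 [mod p ])) where
    open ModReasoning p

    fib-prime : fib m p ≡ + 1 [mod p ]
    fib-prime = *-cancelˡ-mod p-prime distinct (begin
      (α - β) * fib m p    ≈⟨ binet p ⟩
      α ^ p - β ^ p        ≈⟨ sub-cong-mod (fermat p-prime α) (fermat p-prime β) ⟩
      α - β                ≡⟨ sym (ℤP.*-identityʳ (α - β)) ⟩
      (α - β) * + 1        ∎)

    fib-suc-prime : fib m (suc p) ≡ m [mod p ]
    fib-suc-prime = *-cancelˡ-mod p-prime distinct (begin
      (α - β) * fib m (suc p)              ≈⟨ binet (suc p) ⟩
      α * α ^ p - β * β ^ p                ≈⟨ sub-cong-mod (*-cong-mod (mod-refl {a = α}) (fermat p-prime α))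
                                                           (*-cong-mod (mod-refl {a = β}) (fermat p-prime β)) ⟩
      α * α - β * β                        ≈⟨ sub-cong-mod α-root β-root ⟩
      (m * α + + 1) - (m * β + + 1)        ≡⟨ solve m α β ⟩
      (α - β) * m                          ∎)
      where
      solve : ∀ (m a b : ℤ) → (m * a + + 1) - (m * b + + 1) ≡ (a - b) * m
      solve = solve-∀

fib-pred : ∀ m k → fib m k ≡ fib m (suc (suc k)) - m * fib m (suc k)
fib-pred m k = solve m (fib m (suc k)) (fib m k)
  where
  solve : ∀ (m a b : ℤ) → b ≡ m * a + b - m * a
  solve = solve-∀

companionPow-period : ∀ {p} m n → fib m (suc (suc n)) ≡ + 1 [mod p ] → fib m (suc (suc (suc n))) ≡ m [mod p ] →
  companionPow m (suc n) ≡₂ I₂ [mod p ]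
companionPow-period {p} m n fib[n+2]≡1 fib[n+3]≡m =
  subst (λ M → M ≡₂ I₂ [mod p ]) (sym (companionPow-fib m n))
        (fib[n]≡1 , fib[n+1]≡0 , fib[n+1]≡0 , fib[n+2]≡1)
  where
  open ModReasoning p
  fib[n+1]≡0 : fib m (suc n) ≡ + 0 [mod p ]
  fib[n+1]≡0 = begin
    fib m (suc n)                                        ≡⟨ fib-pred m (suc n) ⟩
    fib m (suc (suc (suc n))) - m * fib m (suc (suc n))
      ≈⟨ sub-cong-mod fib[n+3]≡m (*-cong-mod (mod-refl {a = m}) fib[n+2]≡1) ⟩
    m - m * + 1                                          ≡⟨ solve m ⟩
    + 0                                                  ∎
    where
    solve : ∀ (m : ℤ) → m - m * + 1 ≡ + 0
    solve = solve-∀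
  fib[n]≡1 : fib m n ≡ + 1 [mod p ]
  fib[n]≡1 = begin
    fib m n                                        ≡⟨ fib-pred m n ⟩
    fib m (suc (suc n)) - m * fib m (suc n)
      ≈⟨ sub-cong-mod fib[n+2]≡1 (*-cong-mod (mod-refl {a = m}) fib[n+1]≡0) ⟩
    + 1 - m * + 0                                  ≡⟨ solve m ⟩
    + 1                                            ∎
    where
    solve : ∀ (m : ℤ) → + 1 - m * + 0 ≡ + 1
    solve = solve-∀

module _ {p : ℕ} (m x : ℤ) (root : x * x - m * x ≡ + 1 [mod p ]) where

  root⇒α-root : x * x ≡ m * x + + 1 [mod p ]
  root⇒α-root = begin
    x * x                  ≡⟨ solve x m ⟩
    (x * x - m * x) + m * x ≈⟨ +-cong-mod root (mod-refl {a = m * x}) ⟩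
    + 1 + m * x            ≡⟨ ℤP.+-comm (+ 1) (m * x) ⟩
    m * x + + 1            ∎
    where
    open ModReasoning p
    solve : ∀ (x m : ℤ) → x * x ≡ (x * x - m * x) + m * x
    solve = solve-∀

  root⇒β-root : (m - x) * (m - x) ≡ m * (m - x) + + 1 [mod p ]
  root⇒β-root = begin
    (m - x) * (m - x)              ≡⟨ solve x m ⟩
    (x * x - m * x) + m * (m - x)  ≈⟨ +-cong-mod root (mod-refl {a = m * (m - x)}) ⟩
    + 1 + m * (m - x)              ≡⟨ ℤP.+-comm (+ 1) (m * (m - x)) ⟩
    m * (m - x) + + 1              ∎
    where
    open ModReasoning p
    solve : ∀ (x m : ℤ) → (m - x) * (m - x) ≡ (x * x - m * x) + m * (m - x)
    solve = solve-∀

  roots-distinct : Prime p → Coprime p ∣ m * m + + 4 ∣ → ¬ (x - (m - x) ≡ + 0 [mod p ])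
  roots-distinct p-prime coprime D≡0 = ¬prime[1] (subst Prime (coprime (ℕD.∣-refl , p∣m²+4)) p-prime)
    where
    open ModReasoning p
    m²+4≡0 : m * m + + 4 ≡ + 0 [mod p ]
    m²+4≡0 = begin
      m * m + + 4                                         ≡⟨ solve₁ x m ⟩
      (x - (m - x)) * (x - (m - x)) + + 4 * (+ 1 - (x * x - m * x))
        ≈⟨ +-cong-mod (*-cong-mod D≡0 D≡0)
                      (*-cong-mod (mod-refl {a = + 4}) (sub-cong-mod (mod-refl {a = + 1}) root)) ⟩
      + 0 * + 0 + + 4 * (+ 1 - + 1)                       ≡⟨⟩
      + 0                                                 ∎
      where
      solve₁ : ∀ (x m : ℤ) → m * m + + 4 ≡ (x - (m - x)) * (x - (m - x)) + + 4 * (+ 1 - (x * x - m * x))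
      solve₁ = solve-∀
    p∣m²+4 : p ℕD.∣ ∣ m * m + + 4 ∣
    p∣m²+4 = subst (λ z → + p ∣ z) (ℤP.+-identityʳ (m * m + + 4)) (mod⇒∣ m²+4≡0)

companionPow-pred-prime : ∀ {p} → Prime p → ∀ m x → x * x - m * x ≡ + 1 [mod p ] →
  Coprime p ∣ m * m + + 4 ∣ → companionPow m (p ∸ 1) ≡₂ I₂ [mod p ]
companionPow-pred-prime {suc (suc n)} p-prime m x root coprime =
  companionPow-period m n (fib-prime m x (m - x) α-root β-root p-prime distinct)
                          (fib-suc-prime m x (m - x) α-root β-root p-prime distinct)
  where
  α-root : x * x ≡ m * x + + 1 [mod suc (suc n) ]
  α-root = root⇒α-root m x root
  β-root : (m - x) * (m - x) ≡ m * (m - x) + + 1 [mod suc (suc n) ]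
  β-root = root⇒β-root m x root
  distinct : ¬ (x - (m - x) ≡ + 0 [mod suc (suc n) ])
  distinct = roots-distinct m x root p-prime coprime

matPow-T-cong-mod : ∀ {p} m N {k l} → companionPow m k ≡₂ companionPow m l [mod p ] →
  matPow (T (suc N) m) k ≡[mod + p ] matPow (T (suc N) m) l
matPow-T-cong-mod {p} m N {k} {l} Mᵏ≡Mˡ i j =
  subst₂ (λ A B → + p ∣ A - B) (sym (matPow-T≡symPowRow m N k i j)) (sym (matPow-T≡symPowRow m N l i j))
    (mod⇒∣ (symPowRow-cong-mod Mᵏ≡Mˡ N (toℕ i) (toℕ j)))

theorem5p4 : (m : ℤ) (p : ℕ) → Prime p →
    ∃ (λ (x : ℤ) → (+ p) ∣ (x * x - m * x - + 1)) →
    Coprime p ∣ m * m + + 4 ∣ →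
    (n : ℕ) → n ≥ 1 →
    matPow (T n m) (p Data.Nat.∸ 1) ≡[mod (+ p) ] idMat n
theorem5p4 m p p-prime (x , p∣root) coprime (suc N) _ =
  matPow-T-cong-mod m N {p ∸ 1} {0} (companionPow-pred-prime p-prime m x (∣⇒mod p∣root) coprime)
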